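{- Let $D,E,W,V$ be as defined in the context and for $n\ge1$ let $\lambda_n=\alpha\beta-\gamma\delta q^{n-1}$. Then for every word $Y$ in the letters $D,E$ (of length $|Y|$), $$\alpha\,WEYV-\gamma\,WDYV=\lambda_{|Y|+1}\,WYV.$$
   Context: Parameters $\alpha,\beta,\gamma,\delta,q$. For nonnegative integers $i,j,k,\ell$ define $D_{i,j,k,\ell}$ and $E_{i,j,k,\ell}$ recursively (any entry with a negative index is $0$): $D_{i,j,k,\ell}=0$ if $j<i$ or $\ell>k+1$; $=\delta q^i$ if $j=i+1$, $k=\ell=0$; $=\alpha q^i$ if $j=i$, $k=0$, $\ell=1$; otherwise $D_{i,j,k,\ell}=\delta(D_{i,j-1,k-1,\ell}+E_{i,j-1,k-1,\ell})+D_{i,j,k-1,\ell-1}$. $E_{i,j,k,\ell}=0$ if $j<i$ or $\ell>k+1$; $=\beta q^i$ if $j=i$, $k=\ell=0$; $=\gamma q^i$ if $j=i$, $k=0$, $\ell=1$; otherwise $E_{i,j,k,\ell}=\beta(D_{i,j,k-1,\ell}+E_{i,j,k-1,\ell})+qE_{i,j,k-1,\ell-1}$. Matrix products: $(MN)_{i,j,k,\ell}=\sum_{a,b}M_{i,a,k,b}N_{a,j,b,\ell}$; a word in $D,E$ denotes the corresponding product (the empty word is the identity). $W$ is the row vector with $W_{i,k}=1$ if $i=k=0$, else $0$, acting by $(WX)_{j,\ell}=\sum_{i,k}W_{i,k}X_{i,j,k,\ell}$; $V$ is the column vector with all entries $1$, so $WXV=\sum_{j,\ell}(WX)_{j,\ell}$.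 -}

module Defs where

open import Level using (Level)
open import Algebra.Bundles using (CommutativeRing)
open import Data.Nat as ℕ using (ℕ; zero; suc; _<ᵇ_; _≡ᵇ_)
open import Data.Bool using (Bool; true; false; if_then_else_; _∨_; _∧_)
open import Data.Product using (_×_; _,_; proj₁; proj₂)
open import Data.List using (List; []; _∷_; length)

data Letter : Set where
  Dℓ Eℓ : Letter

module Construction {c ℓ' : Level} (R : CommutativeRing c ℓ')
                    (α β γ δ q : CommutativeRing.Carrier R) where
  open CommutativeRing R

  pow : Carrier → ℕ → Carrier
  pow x zero    = 1#
  pow x (suc n) = x * pow x n

  -- (D_{i,j,k,l} , E_{i,j,k,l}), by recursion on k.
  -- Arguments in the order i j k l.
  DE : ℕ → ℕ → ℕ → ℕ → Carrier × Carrier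
  -- value at (i, j-1, k, l), zero when j - 1 is negative
  DEjm : ℕ → ℕ → ℕ → ℕ → Carrier × Carrier
  -- value at (i, j, k, l-1), zero when l - 1 is negative
  DElm : ℕ → ℕ → ℕ → ℕ → Carrier × Carrier

  DE i j zero l =
    if (j <ᵇ i) ∨ (1 <ᵇ l) then (0# , 0#)
    else ( (if (j ≡ᵇ suc i) ∧ (l ≡ᵇ 0) then δ * pow q i
            else if (j ≡ᵇ i) ∧ (l ≡ᵇ 1) then α * pow q i
            else 0#)   -- "otherwise": recursion refers to k-1 < 0, hence 0
         , (if (j ≡ᵇ i) ∧ (l ≡ᵇ 0) then β * pow q i
            else if (j ≡ᵇ i) ∧ (l ≡ᵇ 1) then γ * pow q i
            else 0#) )
  DE i j (suc k) l =
    if (j <ᵇ i) ∨ (suc (suc k) <ᵇ l) then (0# , 0#)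
    else ( δ * (proj₁ (DEjm i j k l) + proj₂ (DEjm i j k l)) + proj₁ (DElm i j k l)
         , β * (proj₁ (DE i j k l) + proj₂ (DE i j k l)) + q * proj₂ (DElm i j k l) )

  DEjm i zero    k l = (0# , 0#)
  DEjm i (suc j) k l = DE i j k l

  DElm i j k zero    = (0# , 0#)
  DElm i j k (suc l) = DE i j k l

  Mat : Set c
  Mat = ℕ → ℕ → ℕ → ℕ → Carrier

  Dm Em : Mat
  Dm i j k l = proj₁ (DE i j k l)
  Em i j k l = proj₂ (DE i j k l)

  letter : Letter → Mat
  letter Dℓ = Dm
  letter Eℓ = Em

  Σ≤ : ℕ → (ℕ → Carrier) → Carrier
  Σ≤ zero    f = f 0
  Σ≤ (suc n) f = Σ≤ n f + f (suc n)

  Id : Mat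
  Id i j k l = if (i ≡ᵇ j) ∧ (k ≡ᵇ l) then 1# else 0#

  -- (X N)_{i,j,k,l} = Σ_{a,b} X_{i,a,k,b} N_{a,j,b,l} for a letter X.
  -- The sum is restricted to a ≤ j and b ≤ k+1: all omitted terms vanish,
  -- since X_{i,a,k,b} = 0 for b > k+1 and N_{a,j,b,l} = 0 for j < a
  -- (N being a product of letters or the identity).
  mulL : Mat → Mat → Mat
  mulL X N i j k l = Σ≤ j (λ a → Σ≤ (suc k) (λ b → X i a k b * N a j b l))

  word : List Letter → Mat
  word []      = Id
  word (x ∷ w) = mulL (letter x) (word w)

  -- W X V = Σ_{j,l} X_{0,j,0,l}.  For a word of length m the entries
  -- X_{0,j,0,l} vanish unless j ≤ m(m+1)/2 and l ≤ m, so the (finite) sum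
  -- over j, l ≤ (m+1)² is the full sum.
  WV : List Letter → Carrier
  WV w = let B = suc (length w) ℕ.* suc (length w) in
         Σ≤ B (λ j → Σ≤ B (λ l → word w 0 j 0 l))

  lam : ℕ → Carrier
  lam n = α * β + - (γ * δ * pow q (n ℕ.∸ 1))

-- Only the first row of the leading letter matters: the only nonzero entries
-- E_{0,j,0,l} are E_{0,0,0,0} = β and E_{0,0,0,1} = γ, and the only nonzero
-- D_{0,j,0,l} are D_{0,0,0,1} = α and D_{0,1,0,0} = δ.  Writing ⟨i,k⟩ for the
-- sum of the row (i,k) of the matrix of Y this gives
--     W E Y V = β⟨0,0⟩ + γ⟨0,1⟩,      W D Y V = α⟨0,1⟩ + δ⟨1,0⟩,
-- and the γ⟨0,1⟩ terms cancel:  α W E Y V − γ W D Y V = αβ⟨0,0⟩ − γδ⟨1,0⟩.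
-- The defining recursion commutes with (i,j) ↦ (i+1,j+1) up to a factor q, so
-- X_{i+1,j+1,k,l} = q X_{i,j,k,l} for a letter, the matrix of Y picks up q^{|Y|},
-- and ⟨1,0⟩ = q^{|Y|}⟨0,0⟩ = q^{|Y|} W Y V, which is the claim.
--
-- Since W X V is formalised as a finite sum over a window depending on the word,
-- we also need the support of words (entries vanish for j < i, for l > k + |Y|
-- and for j > i + |Y|(k + |Y|)) to see that every large window gives W Y V.
module Submission where

open import Defs
open import Algebra.Bundles using (CommutativeRing)
open import Data.Nat using (suc)
open import Data.List using (List; _∷_; length)
open import Data.List using ([])
open import Data.Nat as Nat using (ℕ; zero; _≤_; _<_; _≤′_; ≤′-refl; ≤′-step; z≤n; s≤s; _<ᵇ_; _≡ᵇ_)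
import Data.Nat.Properties as ℕₚ
open import Data.Bool using (true; false; _∧_; _∨_; if_then_else_)
open import Data.Bool.Properties using (T-≡; ¬-not; ∧-zeroʳ)
open import Data.Product using (_×_; _,_; proj₁; proj₂)
open import Function.Bundles using (Equivalence)
open import Relation.Binary.PropositionalEquality as ≡ using (_≡_; _≢_)
open import Relation.Nullary using (yes; no)

≡ᵇ-false : ∀ {m n} → m ≢ n → (m ≡ᵇ n) ≡ false
≡ᵇ-false {m} {n} m≢n = ¬-not (λ m≡ᵇn → m≢n (ℕₚ.≡ᵇ⇒≡ m n (Equivalence.from T-≡ m≡ᵇn)))

<ᵇ-true : ∀ {m n} → m < n → (m <ᵇ n) ≡ true
<ᵇ-true m<n = Equivalence.to T-≡ (ℕₚ.<⇒<ᵇ m<n)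

module _ where
  open Nat using (_+_; _*_)

  -- The j-support of a product X·N: if X_{i,a,k,b} ≠ 0 forces a ≤ i + k + 1 and
  -- b ≤ k + 1, and N (a word of length m) vanishes beyond a + m(b + m), then the
  -- product vanishes beyond i + (m+1)(k + m + 1).
  j-support-step : ∀ i k m a b → a ≤ i + suc k → b ≤ suc k → a + m * (b + m) ≤ i + suc m * (k + suc m)
  j-support-step i k m a b a≤ b≤ = begin
    a + m * (b + m)                         ≤⟨ ℕₚ.+-mono-≤ a≤ (ℕₚ.*-monoʳ-≤ m (ℕₚ.+-monoˡ-≤ m b≤)) ⟩
    (i + suc k) + m * (suc k + m)           ≤⟨ ℕₚ.+-monoˡ-≤ _ (ℕₚ.+-monoʳ-≤ i (ℕₚ.m≤m+n (suc k) m)) ⟩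
    (i + (suc k + m)) + m * (suc k + m)     ≡⟨ ℕₚ.+-assoc i _ _ ⟩
    i + suc m * (suc k + m)                 ≡⟨ ≡.cong (λ t → i + suc m * t) (≡.sym (ℕₚ.+-suc k m)) ⟩
    i + suc m * (k + suc m)                 ∎
    where open ℕₚ.≤-Reasoning

  -- The summation window (m+1)² used by W·V for a word of length m.
  window : ℕ → ℕ
  window m = suc m * suc m

  -- window (m+1) = 1 + window⁻ m; this smaller window still covers the support
  -- of a word of length m (it is the window left after dropping the row j = 0).
  window⁻ : ℕ → ℕ
  window⁻ m = suc m + suc m * suc (suc m)

  square≤window⁻ : ∀ m → m * m ≤ window⁻ m
  square≤window⁻ m = ℕₚ.≤-trans (ℕₚ.*-mono-≤ (ℕₚ.n≤1+n m) (ℕₚ.≤-trans (ℕₚ.n≤1+n m) (ℕₚ.n≤1+n (suc m))))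
                                (ℕₚ.m≤n+m _ (suc m))

  length≤window⁻ : ∀ m → m ≤ window⁻ m
  length≤window⁻ m = ℕₚ.≤-trans (ℕₚ.n≤1+n m) (ℕₚ.m≤m+n (suc m) _)

module Lemma6p6 {c ℓ} (R : CommutativeRing c ℓ) (α β γ δ q : CommutativeRing.Carrier R) where
  open CommutativeRing R hiding (zero)
  open Construction R α β γ δ q
  open import Algebra.Properties.Ring ring using (-‿distribˡ-*)
  open import Algebra.Properties.AbelianGroup +-abelianGroup using (⁻¹-∙-comm)
  open import Algebra.Properties.CommutativeSemigroup +-commutativeSemigroup
    using () renaming (interchange to +-interchange)
  open import Algebra.Properties.CommutativeSemigroup *-commutativeSemigroup
    using () renaming (interchange to *-interchange; x∙yz≈y∙xz to *-swapˡ)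
  open import Relation.Binary.Reasoning.Setoid setoid

  *-vanishʳ : ∀ {x y} → y ≈ 0# → x * y ≈ 0#
  *-vanishʳ y≈0 = trans (*-congˡ y≈0) (zeroʳ _)

  *-vanishˡ : ∀ {x y} → x ≈ 0# → x * y ≈ 0#
  *-vanishˡ x≈0 = trans (*-congʳ x≈0) (zeroˡ _)

  Σ-cong : ∀ n {f g : ℕ → Carrier} → (∀ a → f a ≈ g a) → Σ≤ n f ≈ Σ≤ n g
  Σ-cong zero    f≈g = f≈g 0
  Σ-cong (suc n) f≈g = +-cong (Σ-cong n f≈g) (f≈g (suc n))

  Σ-zero : ∀ n {f : ℕ → Carrier} → (∀ a → a ≤ n → f a ≈ 0#) → Σ≤ n f ≈ 0#
  Σ-zero zero    f≈0 = f≈0 0 z≤n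
  Σ-zero (suc n) f≈0 =
    trans (+-cong (Σ-zero n (λ a a≤n → f≈0 a (ℕₚ.m≤n⇒m≤1+n a≤n))) (f≈0 (suc n) ℕₚ.≤-refl)) (+-identityʳ 0#)

  Σ-+ : ∀ n (f g : ℕ → Carrier) → Σ≤ n (λ a → f a + g a) ≈ Σ≤ n f + Σ≤ n g
  Σ-+ zero    f g = refl
  Σ-+ (suc n) f g = trans (+-congʳ (Σ-+ n f g)) (+-interchange _ _ _ _)

  Σ-*ˡ : ∀ n x (f : ℕ → Carrier) → Σ≤ n (λ a → x * f a) ≈ x * Σ≤ n f
  Σ-*ˡ zero    x f = refl
  Σ-*ˡ (suc n) x f = trans (+-congʳ (Σ-*ˡ n x f)) (sym (distribˡ x _ _))

  Σ-first : ∀ n (f : ℕ → Carrier) → Σ≤ (suc n) f ≈ f 0 + Σ≤ n (λ a → f (suc a))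
  Σ-first zero    f = refl
  Σ-first (suc n) f = trans (+-congʳ (Σ-first n f)) (+-assoc _ _ _)

  Σ-only-first : ∀ n (f : ℕ → Carrier) → (∀ a → f (suc a) ≈ 0#) → Σ≤ n f ≈ f 0
  Σ-only-first zero    f f≈0 = refl
  Σ-only-first (suc n) f f≈0 = trans (+-cong (Σ-only-first n f f≈0) (f≈0 n)) (+-identityʳ _)

  Σ-truncate : ∀ {M N} (f : ℕ → Carrier) → M ≤′ N → (∀ a → M < a → f a ≈ 0#) → Σ≤ N f ≈ Σ≤ M f
  Σ-truncate f ≤′-refl            f≈0 = refl
  Σ-truncate f (≤′-step M≤′N) f≈0 =
    trans (+-cong (Σ-truncate f M≤′N f≈0) (f≈0 _ (s≤s (ℕₚ.≤′⇒≤ M≤′N)))) (+-identityʳ _)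

  Σ² : ℕ → ℕ → (ℕ → ℕ → Carrier) → Carrier
  Σ² J L f = Σ≤ J (λ j → Σ≤ L (λ l → f j l))

  Σ²-cong : ∀ J L {f g : ℕ → ℕ → Carrier} → (∀ j l → f j l ≈ g j l) → Σ² J L f ≈ Σ² J L g
  Σ²-cong J L f≈g = Σ-cong J (λ j → Σ-cong L (f≈g j))

  Σ²-linear : ∀ J L x y (f g : ℕ → ℕ → Carrier) →
              Σ² J L (λ j l → x * f j l + y * g j l) ≈ x * Σ² J L f + y * Σ² J L g
  Σ²-linear J L x y f g =
    trans (Σ-cong J (λ j → trans (Σ-+ L _ _) (+-cong (Σ-*ˡ L x _) (Σ-*ˡ L y _))))
          (trans (Σ-+ J _ _) (+-cong (Σ-*ˡ J x _) (Σ-*ˡ J y _)))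

  Σ²-truncate : ∀ {J L J′ L′} (f : ℕ → ℕ → Carrier) → J ≤ J′ → L ≤ L′ →
                (∀ j l → J < j → f j l ≈ 0#) → (∀ j l → L < l → f j l ≈ 0#) → Σ² J′ L′ f ≈ Σ² J L f
  Σ²-truncate {J} {L} {J′} f J≤J′ L≤L′ f≈0ʲ f≈0ˡ =
    trans (Σ-cong J′ (λ j → Σ-truncate (f j) (ℕₚ.≤⇒≤′ L≤L′) (f≈0ˡ j)))
          (Σ-truncate (λ j → Σ≤ L (f j)) (ℕₚ.≤⇒≤′ J≤J′) (λ j J<j → Σ-zero L (λ l _ → f≈0ʲ j l J<j)))

  Proportional : Carrier → Carrier × Carrier → Carrier × Carrier → Set ℓ
  Proportional x p p′ = (proj₁ p ≈ x * proj₁ p′) × (proj₂ p ≈ x * proj₂ p′)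

  Vanishes : Carrier × Carrier → Set ℓ
  Vanishes p = (proj₁ p ≈ 0#) × (proj₂ p ≈ 0#)

  zero-proportional : ∀ x → Proportional x (0# , 0#) (0# , 0#)
  zero-proportional x = sym (zeroʳ x) , sym (zeroʳ x)

  -- One step of the recursion in k: the pair at (i,j,k+1,l) computed from the
  -- pairs at (i,j−1,k,l), (i,j,k,l) and (i,j,k,l−1).
  step : Carrier × Carrier → Carrier × Carrier → Carrier × Carrier → Carrier × Carrier
  step left here below =
    ( δ * (proj₁ left + proj₂ left) + proj₁ below
    , β * (proj₁ here + proj₂ here) + q * proj₂ below )

  -- The step is linear, hence preserves proportionality by any factor x.
  step-proportional : ∀ {x a a′ b b′ e e′} → Proportional x a a′ → Proportional x b b′ → Proportional x e e′ →
                      Proportional x (step a b e) (step a′ b′ e′)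
  step-proportional {x} (a₁ , a₂) (b₁ , b₂) (e₁ , e₂) =
    combination δ a₁ a₂ e₁ , combination β b₁ b₂ (trans (*-congˡ e₂) (*-swapˡ q x _))
    where
      combination : ∀ u {s t w s′ t′ w′} → s ≈ x * s′ → t ≈ x * t′ → w ≈ x * w′ →
                    u * (s + t) + w ≈ x * (u * (s′ + t′) + w′)
      combination u {s′ = s′} {t′} {w′} s≈ t≈ w≈ = begin
        u * (_ + _) + _                 ≈⟨ +-cong (*-congˡ (+-cong s≈ t≈)) w≈ ⟩
        u * (x * s′ + x * t′) + x * w′  ≈⟨ +-congʳ (*-congˡ (sym (distribˡ x s′ t′))) ⟩
        u * (x * (s′ + t′)) + x * w′    ≈⟨ +-congʳ (*-swapˡ u x _) ⟩
        x * (u * (s′ + t′)) + x * w′    ≈⟨ sym (distribˡ x _ w′) ⟩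
        x * (u * (s′ + t′) + w′)        ∎

  -- Vanishing is proportionality by 0, so it is preserved as well.
  step-vanishes : ∀ {a b e} → Vanishes a → Vanishes b → Vanishes e → Vanishes (step a b e)
  step-vanishes a0 b0 e0 = from0 (step-proportional (to0 a0) (to0 b0) (to0 e0))
    where
      to0 : ∀ {p} → Vanishes p → Proportional 0# p p
      to0 (p₁ , p₂) = trans p₁ (sym (zeroˡ _)) , trans p₂ (sym (zeroˡ _))
      from0 : ∀ {p p′} → Proportional 0# p p′ → Vanishes p
      from0 (p₁ , p₂) = trans p₁ (zeroˡ _) , trans p₂ (zeroˡ _)

  DE-below : ∀ i j k l → j < i → DE i j k l ≡ (0# , 0#)
  DE-below i j zero    l j<i rewrite <ᵇ-true j<i = ≡.refl
  DE-below i j (suc k) l j<i rewrite <ᵇ-true j<i = ≡.refl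

  DE₀-beyond : ∀ i j l → suc i < j → Vanishes (DE i j 0 l)
  DE₀-beyond i j l 1+i<j with (j <ᵇ i) ∨ (1 <ᵇ l)
  ... | true  = refl , refl
  ... | false rewrite ≡ᵇ-false (ℕₚ.>⇒≢ 1+i<j) | ≡ᵇ-false (ℕₚ.>⇒≢ (ℕₚ.<-trans (ℕₚ.n<1+n i) 1+i<j)) = refl , refl

  -- The recursion only looks one step to the left in j, so the support grows by
  -- one with each step in k.
  DE-beyond : ∀ i j k l → i Nat.+ suc k < j → Vanishes (DE i j k l)
  DE-beyond i j zero    l i+1<j = DE₀-beyond i j l (≡.subst (_< j) (ℕₚ.+-comm i 1) i+1<j)
  DE-beyond i j (suc k) l i+k+2<j with (j <ᵇ i) ∨ (suc (suc k) <ᵇ l)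
  ... | true  = refl , refl
  ... | false = step-vanishes (left j i+k+2<j) (DE-beyond i j k l i+k+1<j) (below l)
    where
      i+k+1<j : i Nat.+ suc k < j
      i+k+1<j = ℕₚ.<-trans (ℕₚ.+-monoʳ-< i (ℕₚ.n<1+n (suc k))) i+k+2<j
      left : ∀ j → i Nat.+ suc (suc k) < j → Vanishes (DEjm i j k l)
      left (suc j) (s≤s i+k+2≤j) = DE-beyond i j k l (≡.subst (_≤ j) (ℕₚ.+-suc i (suc k)) i+k+2≤j)
      below : ∀ l → Vanishes (DElm i j k l)
      below zero    = refl , refl
      below (suc l) = DE-beyond i j k l i+k+1<j

  DE-shift : ∀ i j k l → Proportional q (DE (suc i) (suc j) k l) (DE i j k l)
  DE-shift i j zero l with (j <ᵇ i) ∨ (1 <ᵇ l)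
  ... | true  = zero-proportional q
  ... | false = if-prop ((j ≡ᵇ suc i) ∧ (l ≡ᵇ 0)) (*-swapˡ δ q _) (if-prop ((j ≡ᵇ i) ∧ (l ≡ᵇ 1)) (*-swapˡ α q _) q0)
              , if-prop ((j ≡ᵇ i) ∧ (l ≡ᵇ 0)) (*-swapˡ β q _) (if-prop ((j ≡ᵇ i) ∧ (l ≡ᵇ 1)) (*-swapˡ γ q _) q0)
    where
      q0 : 0# ≈ q * 0#
      q0 = sym (zeroʳ q)
      if-prop : ∀ b {x y x′ y′} → x ≈ q * x′ → y ≈ q * y′ → (if b then x else y) ≈ q * (if b then x′ else y′)
      if-prop true  x≈ _  = x≈
      if-prop false _  y≈ = y≈
  DE-shift i j (suc k) l with (j <ᵇ i) ∨ (suc (suc k) <ᵇ l)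
  ... | true  = zero-proportional q
  ... | false = step-proportional (left j) (DE-shift i j k l) (below l)
    where
      left : ∀ j → Proportional q (DEjm (suc i) (suc j) k l) (DEjm i j k l)
      left zero    rewrite DE-below (suc i) 0 k l (s≤s z≤n) = zero-proportional q
      left (suc j) = DE-shift i j k l
      below : ∀ l → Proportional q (DElm (suc i) (suc j) k l) (DElm i j k l)
      below zero    = zero-proportional q
      below (suc l) = DE-shift i j k l

  letter-vanishes : ∀ x {i j k l} → Vanishes (DE i j k l) → letter x i j k l ≈ 0#
  letter-vanishes Dℓ = proj₁
  letter-vanishes Eℓ = proj₂

  letter-below : ∀ x {i j k l} → j < i → letter x i j k l ≈ 0#
  letter-below x {i} {j} {k} {l} j<i = letter-vanishes x (zero-vanishes (DE-below i j k l j<i))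
    where
      zero-vanishes : ∀ {p} → p ≡ (0# , 0#) → Vanishes p
      zero-vanishes ≡.refl = refl , refl

  letter-shift : ∀ x i j k l → letter x (suc i) (suc j) k l ≈ q * letter x i j k l
  letter-shift Dℓ i j k l = proj₁ (DE-shift i j k l)
  letter-shift Eℓ i j k l = proj₂ (DE-shift i j k l)

  word-below : ∀ w i j k l → j < i → word w i j k l ≈ 0#
  word-below []      i j k l j<i rewrite ≡ᵇ-false (ℕₚ.>⇒≢ j<i) = refl
  word-below (x ∷ w) i j k l j<i =
    Σ-zero j (λ a a≤j → Σ-zero (suc k) (λ b _ → *-vanishˡ (letter-below x (ℕₚ.≤-<-trans a≤j j<i))))

  word-l-support : ∀ w i j k l → k Nat.+ length w < l → word w i j k l ≈ 0#
  word-l-support [] i j k l k<l rewrite ≡ᵇ-false (ℕₚ.<⇒≢ (≡.subst (_< l) (ℕₚ.+-identityʳ k) k<l))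
                                      | ∧-zeroʳ (i ≡ᵇ j) = refl
  word-l-support (x ∷ w) i j k l k+m+1<l =
    Σ-zero j (λ a _ → Σ-zero (suc k) (λ b b≤k+1 → *-vanishʳ (word-l-support w a j b l (b+m<l b b≤k+1))))
    where
      b+m<l : ∀ b → b ≤ suc k → b Nat.+ length w < l
      b+m<l b b≤k+1 = ℕₚ.≤-<-trans (ℕₚ.+-monoˡ-≤ (length w) b≤k+1)
                                    (≡.subst (_< l) (ℕₚ.+-suc k (length w)) k+m+1<l)

  word-j-support : ∀ w i j k l → i Nat.+ length w Nat.* (k Nat.+ length w) < j → word w i j k l ≈ 0#
  word-j-support [] i j k l i<j rewrite ≡ᵇ-false (ℕₚ.<⇒≢ (≡.subst (_< j) (ℕₚ.+-identityʳ i) i<j)) = refl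
  word-j-support (x ∷ w) i j k l bound<j = Σ-zero j (λ a _ → Σ-zero (suc k) (λ b → term a b))
    where
      term : ∀ a b → b ≤ suc k → letter x i a k b * word w a j b l ≈ 0#
      term a b b≤k+1 with a Nat.≤? i Nat.+ suc k
      ... | yes a≤ = *-vanishʳ (word-j-support w a j b l
                                  (ℕₚ.≤-<-trans (j-support-step i k (length w) a b a≤ b≤k+1) bound<j))
      ... | no  a≰ = *-vanishˡ (letter-vanishes x (DE-beyond i a k b (ℕₚ.≰⇒> a≰)))

  word-shift : ∀ w i j k l → word w (suc i) (suc j) k l ≈ pow q (length w) * word w i j k l
  word-shift []      i j k l = sym (*-identityˡ _)
  word-shift (x ∷ w) i j k l = begin
    Σ≤ (suc j) shifted                      ≈⟨ Σ-first j shifted ⟩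
    shifted 0 + Σ≤ j (λ a → shifted (suc a)) ≈⟨ +-cong first-vanishes (Σ-cong j rest) ⟩
    0# + Σ≤ j (λ a → qᵐ⁺¹ * original a)    ≈⟨ +-identityˡ _ ⟩
    Σ≤ j (λ a → qᵐ⁺¹ * original a)         ≈⟨ Σ-*ˡ j qᵐ⁺¹ original ⟩
    qᵐ⁺¹ * Σ≤ j original                    ∎
    where
      qᵐ⁺¹ : Carrier
      qᵐ⁺¹ = q * pow q (length w)
      shifted original : ℕ → Carrier
      shifted  a = Σ≤ (suc k) (λ b → letter x (suc i) a k b * word w a (suc j) b l)
      original a = Σ≤ (suc k) (λ b → letter x i a k b * word w a j b l)
      first-vanishes : shifted 0 ≈ 0#
      first-vanishes = Σ-zero (suc k) (λ b _ → *-vanishˡ (letter-below x (s≤s z≤n)))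
      rest : ∀ a → shifted (suc a) ≈ qᵐ⁺¹ * original a
      rest a = trans (Σ-cong (suc k) (λ b → trans (*-cong (letter-shift x i a k b) (word-shift w a j b l))
                                                  (*-interchange q _ _ _)))
                     (Σ-*ˡ (suc k) qᵐ⁺¹ _)

  -- Only E_{0,0,0,0} = β and E_{0,0,0,1} = γ are nonzero in the row (0,0) of E.
  E-row : ∀ (N : Mat) j l → mulL Em N 0 j 0 l ≈ β * N 0 j 0 l + γ * N 0 j 1 l
  E-row N j l = trans (Σ-only-first j _ (λ a → trans (+-cong (zeroˡ _) (zeroˡ _)) (+-identityʳ 0#)))
                      (+-cong (*-congʳ (*-identityʳ β)) (*-congʳ (*-identityʳ γ)))

  -- Only D_{0,0,0,1} = α and D_{0,1,0,0} = δ are nonzero in the row (0,0) of D.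
  -- For j = 0 the δ-term lies outside the sum; it vanishes since N is upper triangular.
  D-row : ∀ (N : Mat) → (∀ l → N 1 0 0 l ≈ 0#) → ∀ j l → mulL Dm N 0 j 0 l ≈ α * N 0 j 1 l + δ * N 1 j 0 l
  D-row N N₁₀≈0 zero l = begin
    0# * N 0 0 0 l + (α * 1#) * N 0 0 1 l ≈⟨ +-cong (zeroˡ _) (*-congʳ (*-identityʳ α)) ⟩
    0# + α * N 0 0 1 l                     ≈⟨ +-comm _ _ ⟩
    α * N 0 0 1 l + 0#                     ≈⟨ +-congˡ (sym (*-vanishʳ (N₁₀≈0 l))) ⟩
    α * N 0 0 1 l + δ * N 1 0 0 l          ∎
  D-row N N₁₀≈0 (suc j) l = begin
    Σ≤ (suc j) entry                        ≈⟨ Σ-first j entry ⟩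
    entry 0 + Σ≤ j (λ a → entry (suc a))    ≈⟨ +-congˡ (Σ-only-first j (λ a → entry (suc a))
                                                  (λ a → trans (+-cong (zeroˡ _) (zeroˡ _)) (+-identityʳ 0#))) ⟩
    entry 0 + entry 1                       ≈⟨ +-cong (trans (+-cong (zeroˡ _) (*-congʳ (*-identityʳ α))) (+-identityˡ _))
                                                      (trans (+-cong (*-congʳ (*-identityʳ δ)) (zeroˡ _)) (+-identityʳ _)) ⟩
    α * N 0 (suc j) 1 l + δ * N 1 (suc j) 0 l ∎
    where
      entry : ℕ → Carrier
      entry a = Σ≤ 1 (λ b → Dm 0 a 0 b * N a (suc j) b l)

  rowSum : List Letter → ℕ → ℕ → ℕ → ℕ → Carrier
  rowSum w i k J L = Σ² J L (λ j l → word w i j k l)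

  rowSum-stable : ∀ w {J L} → length w Nat.* length w ≤ J → length w ≤ L → rowSum w 0 0 J L ≈ WV w
  rowSum-stable w m²≤J m≤L =
    trans (Σ²-truncate (λ j l → word w 0 j 0 l) m²≤J m≤L j-support l-support)
          (sym (Σ²-truncate (λ j l → word w 0 j 0 l) m²≤window m≤window j-support l-support))
    where
      m = length w
      m≤window : m ≤ window m
      m≤window = ℕₚ.≤-trans (ℕₚ.n≤1+n m) (ℕₚ.m≤m*n (suc m) (suc m))
      m²≤window : m Nat.* m ≤ window m
      m²≤window = ℕₚ.*-mono-≤ (ℕₚ.n≤1+n m) (ℕₚ.n≤1+n m)
      j-support : ∀ j l → m Nat.* m < j → word w 0 j 0 l ≈ 0#
      j-support j l = word-j-support w 0 j 0 l
      l-support : ∀ j l → m < l → word w 0 j 0 l ≈ 0#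
      l-support j l = word-l-support w 0 j 0 l

  -- ⟨1,0⟩ = q^{|w|} ⟨0,0⟩: the row j = 0 vanishes, the others are shifted copies.
  rowSum-shift : ∀ w J L → rowSum w 1 0 (suc J) L ≈ pow q (length w) * rowSum w 0 0 J L
  rowSum-shift w J L = begin
    rowSum w 1 0 (suc J) L                                       ≈⟨ Σ-first J _ ⟩
    Σ≤ L (λ l → word w 1 0 0 l) + Σ≤ J (λ j → Σ≤ L (λ l → word w 1 (suc j) 0 l))
      ≈⟨ +-cong (Σ-zero L (λ l _ → word-below w 1 0 0 l (s≤s z≤n)))
                (Σ-cong J (λ j → trans (Σ-cong L (word-shift w 0 j 0)) (Σ-*ˡ L qᵐ _))) ⟩
    0# + Σ≤ J (λ j → qᵐ * Σ≤ L (λ l → word w 0 j 0 l))         ≈⟨ +-identityˡ _ ⟩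
    Σ≤ J (λ j → qᵐ * Σ≤ L (λ l → word w 0 j 0 l))              ≈⟨ Σ-*ˡ J qᵐ _ ⟩
    qᵐ * rowSum w 0 0 J L                                        ∎
    where
      qᵐ : Carrier
      qᵐ = pow q (length w)

  WV-E : ∀ Y → let B = window (suc (length Y)) in WV (Eℓ ∷ Y) ≈ β * rowSum Y 0 0 B B + γ * rowSum Y 0 1 B B
  WV-E Y = trans (Σ²-cong B B (E-row (word Y))) (Σ²-linear B B β γ _ _)
    where B = window (suc (length Y))

  WV-D : ∀ Y → let B = window (suc (length Y)) in WV (Dℓ ∷ Y) ≈ α * rowSum Y 0 1 B B + δ * rowSum Y 1 0 B B
  WV-D Y = trans (Σ²-cong B B (D-row (word Y) (λ l → word-below Y 1 0 0 l (s≤s z≤n)))) (Σ²-linear B B α δ _ _)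
    where B = window (suc (length Y))

  cancel-γ : ∀ a b g d x y z → a * (b * x + g * y) + - (g * (a * y + d * z)) ≈ a * b * x + - (g * d * z)
  cancel-γ a b g d x y z = begin
    a * (b * x + g * y) + - (g * (a * y + d * z))
      ≈⟨ +-cong (distribˡ a _ _) (-‿cong (distribˡ g _ _)) ⟩
    (a * (b * x) + a * (g * y)) + - (g * (a * y) + g * (d * z))
      ≈⟨ +-cong (+-cong (sym (*-assoc a b x)) (*-swapˡ a g y)) (-‿cong (+-congˡ (sym (*-assoc g d z)))) ⟩
    (u + v) + - (v + w)       ≈⟨ +-congˡ (-‿cong (+-comm v w)) ⟩
    (u + v) + - (w + v)       ≈⟨ +-congˡ (sym (⁻¹-∙-comm w v)) ⟩
    (u + v) + (- w + - v)     ≈⟨ +-interchange u v (- w) (- v) ⟩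
    (u + - w) + (v + - v)     ≈⟨ +-congˡ (-‿inverseʳ v) ⟩
    (u + - w) + 0#            ≈⟨ +-identityʳ _ ⟩
    u + - w                   ∎
    where
      u v w : Carrier
      u = a * b * x
      v = g * (a * y)
      w = g * d * z

  collect : ∀ a b g d p x → a * b * x + - (g * d * (p * x)) ≈ (a * b + - (g * d * p)) * x
  collect a b g d p x = sym (trans (distribʳ x _ _)
    (+-congˡ (trans (sym (-‿distribˡ-* _ x)) (-‿cong (*-assoc _ p x)))))

  identity : ∀ Y → α * WV (Eℓ ∷ Y) + - (γ * WV (Dℓ ∷ Y)) ≈ lam (suc (length Y)) * WV Y
  identity Y = begin
    α * WV (Eℓ ∷ Y) + - (γ * WV (Dℓ ∷ Y))                    ≈⟨ +-cong (*-congˡ (WV-E Y)) (-‿cong (*-congˡ (WV-D Y))) ⟩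
    α * (β * ⟨0,0⟩ + γ * ⟨0,1⟩) + - (γ * (α * ⟨0,1⟩ + δ * ⟨1,0⟩)) ≈⟨ cancel-γ α β γ δ ⟨0,0⟩ ⟨0,1⟩ ⟨1,0⟩ ⟩
    α * β * ⟨0,0⟩ + - (γ * δ * ⟨1,0⟩)                       ≈⟨ +-cong (*-congˡ ⟨0,0⟩≈WV) (-‿cong (*-congˡ ⟨1,0⟩≈qᵐWV)) ⟩
    α * β * WV Y + - (γ * δ * (pow q m * WV Y))              ≈⟨ collect α β γ δ (pow q m) (WV Y) ⟩
    lam (suc m) * WV Y                                       ∎
    where
      m = length Y
      B = window (suc m)
      ⟨0,0⟩ ⟨0,1⟩ ⟨1,0⟩ : Carrier
      ⟨0,0⟩ = rowSum Y 0 0 B B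
      ⟨0,1⟩ = rowSum Y 0 1 B B
      ⟨1,0⟩ = rowSum Y 1 0 B B
      m≤B : m ≤ B
      m≤B = ℕₚ.m≤n⇒m≤1+n (length≤window⁻ m)
      ⟨0,0⟩≈WV : ⟨0,0⟩ ≈ WV Y
      ⟨0,0⟩≈WV = rowSum-stable Y (ℕₚ.m≤n⇒m≤1+n (square≤window⁻ m)) m≤B
      ⟨1,0⟩≈qᵐWV : ⟨1,0⟩ ≈ pow q m * WV Y
      ⟨1,0⟩≈qᵐWV = trans (rowSum-shift Y (window⁻ m) B) (*-congˡ (rowSum-stable Y (square≤window⁻ m) m≤B))

lemma6p6 : ∀ {c ℓ} (R : CommutativeRing c ℓ) (α β γ δ q : CommutativeRing.Carrier R) (Y : List Letter) →
    CommutativeRing._≈_ R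
      (CommutativeRing._+_ R (CommutativeRing._*_ R α (Construction.WV R α β γ δ q (Eℓ ∷ Y)))
        (CommutativeRing.-_ R (CommutativeRing._*_ R γ (Construction.WV R α β γ δ q (Dℓ ∷ Y)))))
      (CommutativeRing._*_ R (Construction.lam R α β γ δ q (suc (length Y))) (Construction.WV R α β γ δ q Y))
lemma6p6 R α β γ δ q Y = Lemma6p6.identity R α β γ δ q Y
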